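{- There is a randomized algorithm which, given a parameter $k$ and query access to a monotone function $f:\{0,1\}^n\to\{0,1\}$ with $C(f)\le k$, makes $O(k^7\log n)$ queries to $f$ and with high probability returns a certificate of size $O(k^3)$, i.e. a set $S\subseteq[n]$ together with an assignment $\alpha\in\{0,1\}^S$ such that $f(y)$ is the same for all $y$ with $y_S=\alpha$.
   Context: A set $S\subseteq[n]$ is a certificate for $f$'s value on $x$ if $f(y)=f(x)$ for all $y$ agreeing with $x$ on $S$; $C(f)$ is the maximum over $x$ of the minimum size of such a certificate. $f$ is monotone if $x\le y$ coordinatewise implies $f(x)\le f(y)$. "With high probability" means with probability at least $1-1/\mathrm{poly}(n)$. -}

module Defs where

open import Data.Nat using (ℕ; _+_; _*_; _^_; _≤_)
open import Data.Bool using (Bool; true; false) renaming (_≤_ to _≤ᵇ_)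
open import Data.Fin using (Fin)
open import Data.Fin.Subset using (Subset; _∈_; ∣_∣)
open import Data.Vec using (Vec)
open import Data.List using (List; length)
open import Data.List.Relation.Unary.All using (All)
open import Data.List.Relation.Unary.Unique.Propositional using (Unique)
open import Data.Product using (Σ; ∃; _×_; _,_; proj₁; proj₂)
open import Relation.Binary.PropositionalEquality using (_≡_)

Point : ℕ → Set
Point n = Fin n → Bool

BoolFun : ℕ → Set
BoolFun n = Point n → Bool

_≼_ : ∀ {n} → Point n → Point n → Set
x ≼ y = ∀ i → x i ≤ᵇ y i

Monotone : ∀ {n} → BoolFun n → Set
Monotone f = ∀ x y → x ≼ y → f x ≤ᵇ f y

AgreeOn : ∀ {n} → Subset n → Point n → Point n → Set
AgreeOn S α y = ∀ i → i ∈ S → y i ≡ α i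

IsCertificate : ∀ {n} → BoolFun n → Point n → Subset n → Set
IsCertificate f x S = ∀ y → AgreeOn S x y → f y ≡ f x

CertComplexity≤ : ∀ {n} → BoolFun n → ℕ → Set
CertComplexity≤ {n} f k = ∀ (x : Point n) → Σ (Subset n) λ S → ∣ S ∣ ≤ k × IsCertificate f x S

-- A partial assignment (S, α) with α ∈ {0,1}^S (values of α outside S are
-- ignored) is a certificate for f if f is constant on the subcube y_S = α.
IsCertificateFor : ∀ {n} → BoolFun n → Subset n → Point n → Set
IsCertificateFor f S α = ∀ y z → AgreeOn S α y → AgreeOn S α z → f y ≡ f z

Output : ℕ → Set
Output n = Subset n × Point n

-- Deterministic adaptive query algorithm (decision tree) with oracle
-- access to f : {0,1}^n → {0,1}: an internal node queries f at a point
-- and branches on the answer (first subtree: answer false).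
data QTree (n : ℕ) (A : Set) : Set where
  leaf  : A → QTree n A
  query : Point n → QTree n A → QTree n A → QTree n A

run : ∀ {n A} → QTree n A → BoolFun n → A
run (leaf a) f = a
run (query x t₀ t₁) f with f x
... | false = run t₀ f
... | true  = run t₁ f

cost : ∀ {n A} → QTree n A → BoolFun n → ℕ
cost (leaf a) f = 0
cost (query x t₀ t₁) f with f x
... | false = 1 + cost t₀ f
... | true  = 1 + cost t₁ f

-- A randomized query algorithm: a number r of uniformly random coins
-- and, for every coin outcome, a deterministic query algorithm.
record RandAlg (n : ℕ) (A : Set) : Set where
  field
    coins : ℕ
    tree  : Vec Bool coins → QTree n A
open RandAlg public

-- Pr_ρ [ P ρ ] ≥ 1 - 1/n^d, with ρ uniform on {0,1}^coins:
-- there are at least (1 - 1/n^d)·2^coins distinct coin strings satisfying P.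
ProbAtLeast1-1/n^ : ∀ {n A} (alg : RandAlg n A) → ℕ → (Vec Bool (coins alg) → Set) → Set
ProbAtLeast1-1/n^ {n} alg d P =
  Σ (List (Vec Bool (coins alg))) λ good →
    Unique good × All P good ×
    (2 ^ coins alg) * (n ^ d) ≤ length good * (n ^ d) + 2 ^ coins alg

{-# OPTIONS --safe #-}
module Submission where

-- For monotone f a deterministic search suffices. If f(1…1) = 0 then f ≡ 0 and anything
-- certifies. Otherwise maintain a set T of coordinates and a threshold h such that f = 1 on
-- the indicator of T ∪ {j | j < h}, every j ∈ T has j ≥ h, and switching off any one i ∈ T
-- makes f = 0. Every such i is sensitive, so it lies in every certificate of that point and
-- ∣T∣ ≤ C(f) ≤ k. If f = 1 on T alone, T fixed to ones is a certificate by monotonicity.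
-- Otherwise a binary search over h (⌈log₂ n⌉ queries) finds m < h with f = 0 on T ∪ [0, m)
-- and f = 1 on T ∪ [0, m], and (T ∪ {m}, m) satisfies the invariant again. As T grows in
-- every round, k + 1 rounds suffice: O(k log n) queries and a certificate of size at most k.

open import Defs
open import Data.Bool using (true; false; b≤b) renaming (_≤_ to _≤ᵇ_)
import Data.Bool.Properties as Bool
open import Data.Fin using (Fin; toℕ; fromℕ<)
open import Data.Fin.Properties using (toℕ<n; toℕ-injective; toℕ-fromℕ<)
open import Data.Fin.Subset using (Subset; _∈_; _∉_; _⊆_; _∪_; _─_; _-_; ⁅_⁆; ⊥; ∣_∣)
open import Data.Fin.Subset.Properties
  using (_∈?_; ⊆-refl; ⊆-trans; ⊆-reflexive; ∪-assoc; p⊆p∪q; p⊆q⇒∣p∣≤∣q∣; p⊂q⇒∣p∣<∣q∣;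
         x∈p∪q⁺; x∈p∪q⁻; p─q⊆p; x∈p∧x≢y⇒x∈p-y; x∈⁅x⁆; ∉⊥; ∣⊥∣≡0)
import Data.List as List
import Data.List.Relation.Unary.All as All
import Data.List.Relation.Unary.AllPairs as AllPairs
open import Data.Nat using (ℕ; zero; suc; _+_; _*_; _^_; _∸_; _≤_; _<_; z≤n; s≤s; ⌈_/2⌉; ⌊_/2⌋)
open import Data.Nat.Induction using (<-rec)
open import Data.Nat.Logarithm using (⌈log₂_⌉; ⌈log₂⌉-mono-≤; ⌈log₂⌈n/2⌉⌉≡⌈log₂n⌉∸1; ⌈log₂2^n⌉≡n)
open import Data.Nat.Properties
open import Data.Nat.Solver using (module +-*-Solver)
open import Data.Product using (Σ; ∃-syntax; _×_; _,_; proj₁; proj₂; map₁)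
open import Data.Sum using (inj₁; inj₂; [_,_]′)
open import Data.Vec using ([]; _∷_; here; there; tabulate; lookup)
open import Data.Vec.Properties using ([]=⇒lookup; lookup⇒[]=; lookup∘tabulate)
open import Function using (_∘_)
open import Relation.Binary.PropositionalEquality
open import Relation.Nullary using (yes; no; does; contradiction)
open import Relation.Nullary.Decidable using (dec-true)
open import Relation.Unary using (Pred; Decidable)

true≤⇒≡true : ∀ {b} → true ≤ᵇ b → b ≡ true
true≤⇒≡true b≤b = refl

module _ {n} {f : BoolFun n} (mono : Monotone f) {x y : Point n} (x≼y : x ≼ y) where

  monotone-true : f x ≡ true → f y ≡ true
  monotone-true fx = true≤⇒≡true (subst (_≤ᵇ f y) fx (mono x y x≼y))

  monotone-false : f y ≡ false → f x ≡ false
  monotone-false fy with f x in fx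
  ... | false = refl
  ... | true  = trans (sym (monotone-true fx)) fy

x∈p─q⇒x∉q : ∀ {n} (p q : Subset n) {x} → x ∈ p ─ q → x ∉ q
x∈p─q⇒x∉q (_ ∷ p) (true ∷ q) ()        here
x∈p─q⇒x∉q (_ ∷ p) (_    ∷ q) (there x∈) (there x∈q) = x∈p─q⇒x∉q p q x∈ x∈q

module _ {n : ℕ} where

  ∈⇒lookup≤ : ∀ {p q : Subset n} {x} → (x ∈ p → x ∈ q) → lookup p x ≤ᵇ lookup q x
  ∈⇒lookup≤ {p} {q} {x} p→q with lookup p x in px
  ... | false = Bool.≤-minimum (lookup q x)
  ... | true rewrite []=⇒lookup (p→q (lookup⇒[]= x p px)) = b≤b

  ∈⇔⇒lookup≡ : ∀ {p q : Subset n} {x} → (x ∈ p → x ∈ q) → (x ∈ q → x ∈ p) → lookup p x ≡ lookup q x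
  ∈⇔⇒lookup≡ p→q q→p = Bool.≤-antisym (∈⇒lookup≤ p→q) (∈⇒lookup≤ q→p)

  ⊆⇒lookup≼ : ∀ {p q : Subset n} → p ⊆ q → lookup p ≼ lookup q
  ⊆⇒lookup≼ p⊆q x = ∈⇒lookup≤ p⊆q

  full⇒ones≼lookup : ∀ {p : Subset n} → (∀ x → x ∈ p) → (λ _ → true) ≼ lookup p
  full⇒ones≼lookup {p} full x rewrite []=⇒lookup (full x) = b≤b

  ∪-lub : ∀ {p q r : Subset n} → p ⊆ r → q ⊆ r → p ∪ q ⊆ r
  ∪-lub {p} {q} p⊆r q⊆r x∈p∪q = [ (λ x∈p → p⊆r x∈p) , (λ x∈q → q⊆r x∈q) ]′ (x∈p∪q⁻ p q x∈p∪q)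

  ∪-mono : ∀ {p p′ q q′ : Subset n} → p ⊆ p′ → q ⊆ q′ → p ∪ q ⊆ p′ ∪ q′
  ∪-mono p⊆p′ q⊆q′ = ∪-lub (λ x∈p → x∈p∪q⁺ (inj₁ (p⊆p′ x∈p))) (λ x∈q → x∈p∪q⁺ (inj₂ (q⊆q′ x∈q)))

  x∈p-y⁻ : ∀ {p : Subset n} {x y} → x ∈ p - y → x ∈ p × x ≢ y
  x∈p-y⁻ {p} {x} x∈p-y = p─q⊆p p ⁅ _ ⁆ x∈p-y , λ { refl → x∈p─q⇒x∉q p ⁅ x ⁆ x∈p-y (x∈⁅x⁆ x) }

  ∪-remove⁺ : ∀ {p q : Subset n} {x y} → x ≢ y → x ∈ p ∪ q → x ∈ (p - y) ∪ q
  ∪-remove⁺ {p} {q} x≢y x∈p∪q =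
    x∈p∪q⁺ ([ (λ x∈p → inj₁ (x∈p∧x≢y⇒x∈p-y x∈p x≢y)) , inj₂ ]′ (x∈p∪q⁻ p q x∈p∪q))

  ∪-remove⊆ : ∀ {p q : Subset n} {y} → (p ∪ q) - y ⊆ (p - y) ∪ q
  ∪-remove⊆ x∈ = let x∈p∪q , x≢y = x∈p-y⁻ x∈ in ∪-remove⁺ x≢y x∈p∪q

  remove-∪⊆ : ∀ {p q : Subset n} {y} → (∀ {x} → x ∈ q → x ≡ y) → (p ∪ q) - y ⊆ p
  remove-∪⊆ {p} {q} q⊆y x∈ with x∈p-y⁻ x∈
  ... | x∈p∪q , x≢y = [ (λ x∈p → x∈p) , (λ x∈q → contradiction (q⊆y x∈q) x≢y) ]′ (x∈p∪q⁻ p q x∈p∪q)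

  select : ∀ {ℓ} {P : Pred (Fin n) ℓ} → Decidable P → Subset n
  select P? = tabulate (does ∘ P?)

  module _ {ℓ} {P : Pred (Fin n) ℓ} (P? : Decidable P) {x : Fin n} where

    ∈-select⁺ : P x → x ∈ select P?
    ∈-select⁺ px = lookup⇒[]= x _ (trans (lookup∘tabulate (does ∘ P?) x) (dec-true (P? x) px))

    ∈-select⁻ : x ∈ select P? → P x
    ∈-select⁻ x∈ with P? x | trans (sym (lookup∘tabulate (does ∘ P?) x)) ([]=⇒lookup x∈)
    ... | yes px | _ = px

SensitiveAt : ∀ {n} → BoolFun n → Point n → Fin n → Set
SensitiveAt f x i = ∃[ y ] (∀ j → j ≢ i → y j ≡ x j) × f y ≢ f x

module _ {n} {f : BoolFun n} where

  sensitive∈certificate : ∀ {x S i} → IsCertificate f x S → SensitiveAt f x i → i ∈ S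
  sensitive∈certificate {S = S} {i} isCert (y , y≈x , fy≢fx) with i ∈? S
  ... | yes i∈S = i∈S
  ... | no  i∉S = contradiction (isCert y (λ j j∈S → y≈x j (λ { refl → i∉S j∈S }))) fy≢fx

  ∣sensitive∣≤C : ∀ {k x} {T : Subset n} → CertComplexity≤ f k →
                  (∀ {i} → i ∈ T → SensitiveAt f x i) → ∣ T ∣ ≤ k
  ∣sensitive∣≤C {x = x} cert sensitive with cert x
  ... | S , ∣S∣≤k , isCert =
    ≤-trans (p⊆q⇒∣p∣≤∣q∣ (λ i∈T → sensitive∈certificate isCert (sensitive i∈T))) ∣S∣≤k

  module _ (mono : Monotone f) where

    upward-certificate : ∀ {S} → f (lookup S) ≡ true → IsCertificateFor f S (λ _ → true)
    upward-certificate {S} fS y z agree-y agree-z = trans (accepts agree-y) (sym (accepts agree-z))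
      where
      accepts : ∀ {y} → AgreeOn S (λ _ → true) y → f y ≡ true
      accepts {y} agree = monotone-true mono S≼y fS
        where
        S≼y : lookup S ≼ y
        S≼y j with lookup S j in Sj
        ... | false = Bool.≤-minimum (y j)
        ... | true rewrite agree j (lookup⇒[]= j S Sj) = b≤b

    rejecting-certificate : f (λ _ → true) ≡ false → ∀ S α → IsCertificateFor f S α
    rejecting-certificate f1≡false S α y z _ _ = trans (rejects y) (sym (rejects z))
      where
      rejects : ∀ y → f y ≡ false
      rejects y = monotone-false mono (λ j → Bool.≤-maximum (y j)) f1≡false

module _ {n : ℕ} {A : Set} where

  binarySearch : (ℕ → Point n) → ℕ → ℕ → (ℕ → QTree n A) → QTree n A
  binarySearch q zero    lo K = K lo
  binarySearch q (suc c) lo K =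
    query (q (lo + 2 ^ c)) (binarySearch q c (lo + 2 ^ c) K) (binarySearch q c lo K)

  cost-binarySearch : ∀ (f : BoolFun n) q c lo K {B} → (∀ m → cost (K m) f ≤ B) →
                      cost (binarySearch q c lo K) f ≤ c + B
  cost-binarySearch f q zero    lo K cost-K = cost-K lo
  cost-binarySearch f q (suc c) lo K cost-K with f (q (lo + 2 ^ c))
  ... | false = s≤s (cost-binarySearch f q c (lo + 2 ^ c) K cost-K)
  ... | true  = s≤s (cost-binarySearch f q c lo K cost-K)

  binarySearch-threshold : ∀ (f : BoolFun n) q c lo K →
    f (q lo) ≡ false → f (q (lo + 2 ^ c)) ≡ true →
    ∃[ m ] f (q m) ≡ false × f (q (suc m)) ≡ true × run (binarySearch q c lo K) f ≡ run (K m) f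
  binarySearch-threshold f q zero lo K f-lo f-hi =
    lo , f-lo , subst (λ m → f (q m) ≡ true) (+-comm lo 1) f-hi , refl
  binarySearch-threshold f q (suc c) lo K f-lo f-hi with f (q (lo + 2 ^ c)) in f-mid
  ... | false =
    binarySearch-threshold f q c (lo + 2 ^ c) K f-mid (subst (λ m → f (q m) ≡ true) halves f-hi)
    where
    halves : lo + 2 ^ suc c ≡ lo + 2 ^ c + 2 ^ c
    halves = trans (cong (λ e → lo + (2 ^ c + e)) (+-identityʳ (2 ^ c)))
                   (sym (+-assoc lo (2 ^ c) (2 ^ c)))
  ... | true  = binarySearch-threshold f q c lo K f-lo f-mid

deterministic : ∀ {n A} → QTree n A → RandAlg n A
deterministic t = record { coins = 0 ; tree = λ _ → t }

deterministic-succeeds : ∀ {n A} (t : QTree n A) d {P} → P [] →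
                         ProbAtLeast1-1/n^ (deterministic t) d P
deterministic-succeeds {n} _ d P[] =
  [] List.∷ List.[] , All.[] AllPairs.∷ AllPairs.[] , P[] All.∷ All.[] , m≤m+n (1 * n ^ d) 1

1≤⌈log₂n⌉ : ∀ {n} → 2 ≤ n → 1 ≤ ⌈log₂ n ⌉
1≤⌈log₂n⌉ {n} 2≤n = subst (_≤ ⌈log₂ n ⌉) (⌈log₂2^n⌉≡n 1) (⌈log₂⌉-mono-≤ 2≤n)

n≤2^⌈log₂n⌉ : ∀ n → n ≤ 2 ^ ⌈log₂ n ⌉
n≤2^⌈log₂n⌉ = <-rec (λ n → n ≤ 2 ^ ⌈log₂ n ⌉) bound
  where
  bound : ∀ n → (∀ {m} → m < n → m ≤ 2 ^ ⌈log₂ m ⌉) → n ≤ 2 ^ ⌈log₂ n ⌉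
  bound zero          _  = z≤n
  bound (suc zero)    _  = m^n>0 2 ⌈log₂ 1 ⌉
  bound n@(suc (suc m)) ih = begin
      n                                      ≡⟨ ⌊n/2⌋+⌈n/2⌉≡n n ⟨
      ⌊ n /2⌋ + ⌈ n /2⌉                      ≤⟨ +-monoˡ-≤ ⌈ n /2⌉ (⌊n/2⌋≤⌈n/2⌉ n) ⟩
      ⌈ n /2⌉ + ⌈ n /2⌉                      ≤⟨ +-mono-≤ half-bound half-bound ⟩
      2 ^ (⌈log₂ n ⌉ ∸ 1) + 2 ^ (⌈log₂ n ⌉ ∸ 1) ≡⟨ doubling (1≤⌈log₂n⌉ {n} (s≤s (s≤s z≤n))) ⟩
      2 ^ ⌈log₂ n ⌉                          ∎
    where
    open ≤-Reasoning
    half-bound : ⌈ n /2⌉ ≤ 2 ^ (⌈log₂ n ⌉ ∸ 1)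
    half-bound = subst (λ e → ⌈ n /2⌉ ≤ 2 ^ e) (⌈log₂⌈n/2⌉⌉≡⌈log₂n⌉∸1 n) (ih (⌈n/2⌉<n m))
    doubling : ∀ {L} → 1 ≤ L → 2 ^ (L ∸ 1) + 2 ^ (L ∸ 1) ≡ 2 ^ L
    doubling {suc L} _ = cong (2 ^ L +_) (sym (+-identityʳ (2 ^ L)))

m≤m^n : ∀ m n → 1 ≤ m → 1 ≤ n → m ≤ m ^ n
m≤m^n m@(suc _) n _ 1≤n = subst (_≤ m ^ n) (*-identityʳ m) (^-monoʳ-≤ m 1≤n)

k≤5*k^3 : ∀ k → 1 ≤ k → k ≤ 5 * (k ^ 3)
k≤5*k^3 k 1≤k = ≤-trans (m≤m^n k 3 1≤k (s≤s z≤n)) (m≤n*m (k ^ 3) 5)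

query-count≤ : ∀ k b → 1 ≤ k → 1 ≤ b → suc (suc k * suc b) ≤ 5 * (k ^ 7) * b
query-count≤ k@(suc k′) b@(suc b′) 1≤k _ = begin
  suc (suc k * suc b)  ≤⟨ m≤m+n _ (3 * k′ + 3 * b′ + 4 * (k′ * b′)) ⟩
  suc (suc k * suc b) + (3 * k′ + 3 * b′ + 4 * (k′ * b′))  ≡⟨ expand k′ b′ ⟩
  5 * (k * b)          ≤⟨ *-monoʳ-≤ 5 (*-monoˡ-≤ b (m≤m^n k 7 1≤k (s≤s z≤n))) ⟩
  5 * (k ^ 7 * b)      ≡⟨ *-assoc 5 (k ^ 7) b ⟨
  5 * (k ^ 7) * b      ∎
  where
  open ≤-Reasoning
  open +-*-Solver
  expand : ∀ k′ b′ → suc (suc (suc k′) * suc (suc b′)) + (3 * k′ + 3 * b′ + 4 * (k′ * b′))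
                     ≡ 5 * (suc k′ * suc b′)
  expand = solve 2 (λ k′ b′ →
      (con 1 :+ (con 2 :+ k′) :* (con 2 :+ b′)) :+ (con 3 :* k′ :+ con 3 :* b′ :+ con 4 :* (k′ :* b′))
    := con 5 :* ((con 1 :+ k′) :* (con 1 :+ b′))) refl

module CertificateSearch (n k : ℕ) where

  prefix : ℕ → Subset n
  prefix h = select (λ j → toℕ j <? h)

  single : ℕ → Subset n
  single m = select (λ j → toℕ j ≟ m)

  ones : Point n
  ones _ = true

  -- r is fuel: the leaf at r = 0 is never reached, as ∣T∣ ≤ k and T grows every round.
  loop : ℕ → Subset n → QTree n (Output n)
  loop zero    T = leaf (T , ones)
  loop (suc r) T = query (lookup T)
    (binarySearch (λ h → lookup (T ∪ prefix h)) ⌈log₂ n ⌉ 0 (λ m → loop r (T ∪ single m)))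
    (leaf (T , ones))

  findCertificate : QTree n (Output n)
  findCertificate = query ones (leaf (⊥ , ones)) (loop (suc k) ⊥)

  cost-loop : ∀ f r T → cost (loop r T) f ≤ r * suc ⌈log₂ n ⌉
  cost-loop f zero    T = z≤n
  cost-loop f (suc r) T with f (lookup T)
  ... | false = s≤s (cost-binarySearch f _ ⌈log₂ n ⌉ 0 _ (λ m → cost-loop f r (T ∪ single m)))
  ... | true  = s≤s z≤n

  cost-findCertificate : ∀ f → cost findCertificate f ≤ suc (suc k * suc ⌈log₂ n ⌉)
  cost-findCertificate f with f ones
  ... | false = s≤s z≤n
  ... | true  = s≤s (cost-loop f (suc k) ⊥)

  module _ {j : Fin n} where

    ∈prefix⁺ : ∀ {h} → toℕ j < h → j ∈ prefix h
    ∈prefix⁺ {h} = ∈-select⁺ (λ j → toℕ j <? h)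

    ∈prefix⁻ : ∀ {h} → j ∈ prefix h → toℕ j < h
    ∈prefix⁻ {h} = ∈-select⁻ (λ j → toℕ j <? h)

    ∈single⁺ : ∀ {m} → toℕ j ≡ m → j ∈ single m
    ∈single⁺ {m} = ∈-select⁺ (λ j → toℕ j ≟ m)

    ∈single⁻ : ∀ {m} → j ∈ single m → toℕ j ≡ m
    ∈single⁻ {m} = ∈-select⁻ (λ j → toℕ j ≟ m)

    ∉prefix0 : j ∉ prefix 0
    ∉prefix0 j∈ = contradiction (∈prefix⁻ {0} j∈) λ ()

    ∈prefix-n : j ∈ prefix n
    ∈prefix-n = ∈prefix⁺ (toℕ<n j)

  prefix-mono : ∀ {h h′} → h ≤ h′ → prefix h ⊆ prefix h′
  prefix-mono h≤h′ j∈ = ∈prefix⁺ (<-≤-trans (∈prefix⁻ j∈) h≤h′)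

  prefix-suc⊆ : ∀ {m} → prefix (suc m) ⊆ single m ∪ prefix m
  prefix-suc⊆ j∈ with m<1+n⇒m<n∨m≡n (∈prefix⁻ j∈)
  ... | inj₁ j<m = x∈p∪q⁺ (inj₂ (∈prefix⁺ j<m))
  ... | inj₂ j≡m = x∈p∪q⁺ (inj₁ (∈single⁺ j≡m))

  single⊆prefix : ∀ {m h} → m < h → single m ⊆ prefix h
  single⊆prefix m<h j∈ = ∈prefix⁺ (subst (_< _) (sym (∈single⁻ j∈)) m<h)

  module Correctness {f : BoolFun n} (mono : Monotone f) (cert : CertComplexity≤ f k) where

    ⊆-true : ∀ {S S′} → S ⊆ S′ → f (lookup S) ≡ true → f (lookup S′) ≡ true
    ⊆-true S⊆S′ = monotone-true mono (⊆⇒lookup≼ S⊆S′)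

    ⊆-false : ∀ {S S′} → S ⊆ S′ → f (lookup S′) ≡ false → f (lookup S) ≡ false
    ⊆-false S⊆S′ = monotone-false mono (⊆⇒lookup≼ S⊆S′)

    record Invariant (T : Subset n) (h : ℕ) : Set where
      field
        h≤n      : h ≤ n
        accepts  : f (lookup (T ∪ prefix h)) ≡ true
        h≤T      : ∀ {j} → j ∈ T → h ≤ toℕ j
        critical : ∀ {i} → i ∈ T → f (lookup ((T - i) ∪ prefix h)) ≡ false
    open Invariant

    SmallCertificate : Output n → Set
    SmallCertificate o = ∣ proj₁ o ∣ ≤ k × IsCertificateFor f (proj₁ o) (proj₂ o)

    ∣T∣≤k : ∀ {T h} → Invariant T h → ∣ T ∣ ≤ k
    ∣T∣≤k {T} {h} inv = ∣sensitive∣≤C cert sensitive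
      where
      sensitive : ∀ {i} → i ∈ T → SensitiveAt f (lookup (T ∪ prefix h)) i
      sensitive {i} i∈T = lookup ((T - i) ∪ prefix h) , agree , flips
        where
        agree : ∀ j → j ≢ i → lookup ((T - i) ∪ prefix h) j ≡ lookup (T ∪ prefix h) j
        agree j j≢i = ∈⇔⇒lookup≡ (∪-mono (p─q⊆p T ⁅ i ⁆) ⊆-refl) (∪-remove⁺ j≢i)
        flips : f (lookup ((T - i) ∪ prefix h)) ≢ f (lookup (T ∪ prefix h))
        flips rewrite critical inv i∈T | accepts inv = λ ()

    threshold<h : ∀ {T h m} → Invariant T h → f (lookup (T ∪ prefix m)) ≡ false → m < h
    threshold<h {T} {h} {m} inv rejects = ≰⇒> λ h≤m →
      let accepts-m = ⊆-true {T ∪ prefix h} {T ∪ prefix m} (∪-mono ⊆-refl (prefix-mono h≤m)) (accepts inv)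
      in  contradiction (trans (sym rejects) accepts-m) λ ()

    extend-invariant : ∀ {T h m} → Invariant T h → m < h →
                       f (lookup (T ∪ prefix m)) ≡ false → f (lookup (T ∪ prefix (suc m))) ≡ true →
                       Invariant (T ∪ single m) m
    extend-invariant {T} {h} {m} inv m<h rejects accepts-suc = record
      { h≤n      = ≤-trans (<⇒≤ m<h) (h≤n inv)
      ; accepts  = ⊆-true {T ∪ prefix (suc m)} {T′ ∪ prefix m} grown accepts-suc
      ; h≤T      = λ j∈ → [ (λ j∈T → ≤-trans (<⇒≤ m<h) (h≤T inv j∈T))
                           , (λ j∈m → ≤-reflexive (sym (∈single⁻ j∈m)))
                           ]′ (x∈p∪q⁻ T _ j∈)
      ; critical = λ {i} i∈ → [ (λ i∈T → ⊆-false {(T′ - i) ∪ prefix m} shrunk-old (critical inv i∈T))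
                               , (λ i∈m → ⊆-false {(T′ - i) ∪ prefix m} (shrunk-new i∈m) rejects)
                               ]′ (x∈p∪q⁻ T _ i∈)
      }
      where
      T′ = T ∪ single m
      grown : T ∪ prefix (suc m) ⊆ T′ ∪ prefix m
      grown = ⊆-trans (∪-mono ⊆-refl prefix-suc⊆) (⊆-reflexive (sym (∪-assoc T _ _)))
      shrunk-old : ∀ {i} → (T′ - i) ∪ prefix m ⊆ (T - i) ∪ prefix h
      shrunk-old = ∪-lub (⊆-trans ∪-remove⊆ (∪-mono ⊆-refl (single⊆prefix m<h)))
                           (λ j∈ → x∈p∪q⁺ (inj₂ (prefix-mono (<⇒≤ m<h) j∈)))
      shrunk-new : ∀ {i} → i ∈ single m → (T′ - i) ∪ prefix m ⊆ T ∪ prefix m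
      shrunk-new i∈m =
        ∪-mono (remove-∪⊆ λ j∈m → toℕ-injective (trans (∈single⁻ j∈m) (sym (∈single⁻ i∈m)))) ⊆-refl

    ∣T∣<∣T∪single∣ : ∀ {T h m} → Invariant T h → m < h → ∣ T ∣ < ∣ T ∪ single m ∣
    ∣T∣<∣T∪single∣ {T} {h} {m} inv m<h =
      p⊂q⇒∣p∣<∣q∣ (p⊆p∪q _ , m′ , x∈p∪q⁺ (inj₂ (∈single⁺ toℕm′≡m)) , m′∉T)
      where
      m<n = <-≤-trans m<h (h≤n inv)
      m′ = fromℕ< m<n
      toℕm′≡m = toℕ-fromℕ< m<n
      m′∉T : m′ ∉ T
      m′∉T m′∈T = <⇒≱ m<h (subst (h ≤_) toℕm′≡m (h≤T inv m′∈T))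

    search-starts-rejecting : ∀ {T} → f (lookup T) ≡ false → f (lookup (T ∪ prefix 0)) ≡ false
    search-starts-rejecting {T} =
      ⊆-false {T ∪ prefix 0} {T} (∪-lub ⊆-refl (λ j∈ → contradiction j∈ ∉prefix0))

    search-ends-accepting : ∀ {T h} → Invariant T h → f (lookup (T ∪ prefix (2 ^ ⌈log₂ n ⌉))) ≡ true
    search-ends-accepting {T} {h} inv =
      ⊆-true {T ∪ prefix h} (∪-mono ⊆-refl (prefix-mono (≤-trans (h≤n inv) (n≤2^⌈log₂n⌉ n)))) (accepts inv)

    loop-correct : ∀ r {T h} → Invariant T h → k < ∣ T ∣ + r → SmallCertificate (run (loop r T) f)
    loop-correct zero {T} inv k<∣T∣+0 =
      contradiction (∣T∣≤k inv) (<⇒≱ (subst (k <_) (+-identityʳ ∣ T ∣) k<∣T∣+0))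
    loop-correct (suc r) {T} {h} inv k< with f (lookup T) in f-T
    ... | true  = ∣T∣≤k inv , upward-certificate mono f-T
    ... | false
      with binarySearch-threshold f (λ h → lookup (T ∪ prefix h)) ⌈log₂ n ⌉ 0 (λ m → loop r (T ∪ single m))
             (search-starts-rejecting {T} f-T) (search-ends-accepting inv)
    ... | m , rejects , accepts-suc , run≡ rewrite run≡ =
      loop-correct r (extend-invariant inv m<h rejects accepts-suc)
        (≤-trans k< (≤-trans (≤-reflexive (+-suc ∣ T ∣ r)) (+-monoˡ-≤ r (∣T∣<∣T∪single∣ inv m<h))))
      where
      m<h : m < h
      m<h = threshold<h inv rejects

    initial-invariant : f ones ≡ true → Invariant ⊥ n
    initial-invariant accepts-ones = record
      { h≤n      = ≤-refl
      ; accepts  = monotone-true mono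
                     (full⇒ones≼lookup {p = ⊥ ∪ prefix n} λ _ → x∈p∪q⁺ (inj₂ ∈prefix-n)) accepts-ones
      ; h≤T      = λ j∈⊥ → contradiction j∈⊥ ∉⊥
      ; critical = λ i∈⊥ → contradiction i∈⊥ ∉⊥
      }

    findCertificate-correct : SmallCertificate (run findCertificate f)
    findCertificate-correct with f ones in f-ones
    ... | false = subst (_≤ k) (sym (∣⊥∣≡0 n)) z≤n , rejecting-certificate mono f-ones ⊥ ones
    ... | true  = loop-correct (suc k) (initial-invariant f-ones) (m≤n+m (suc k) ∣ ⊥ {n = n} ∣)

theorem5 : Σ ℕ λ c → Σ ℕ λ d → 1 ≤ d ×
    (∀ (n k : ℕ) → 2 ≤ n → 1 ≤ k →
      Σ (RandAlg n (Output n)) λ alg →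
        ∀ (f : BoolFun n) → Monotone f → CertComplexity≤ f k →
          (∀ ρ → cost (tree alg ρ) f ≤ c * (k ^ 7) * ⌈log₂ n ⌉)
          × ProbAtLeast1-1/n^ alg d (λ ρ →
              ∣ proj₁ (run (tree alg ρ) f) ∣ ≤ c * (k ^ 3)
              × IsCertificateFor f (proj₁ (run (tree alg ρ) f)) (proj₂ (run (tree alg ρ) f))))
theorem5 = 5 , 1 , ≤-refl , λ n k 2≤n 1≤k →
  let open CertificateSearch n k in
  deterministic findCertificate , λ f mono cert →
    (λ _ → ≤-trans (cost-findCertificate f) (query-count≤ k ⌈log₂ n ⌉ 1≤k (1≤⌈log₂n⌉ {n} 2≤n)))
    , deterministic-succeeds findCertificate 1
        (map₁ (λ ∣S∣≤k → ≤-trans ∣S∣≤k (k≤5*k^3 k 1≤k)) (Correctness.findCertificate-correct mono cert))
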